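{- Let $n\geq 4$ be an even integer. Then for every integer $r\in[0,n-1]$ there exists a graph $G$ of order $n$ such that $\mathrm{mp}(G)+\mathrm{mp}(\overline{G})=r$. Moreover, this can be realized with $\mathrm{mp}(G)=r$ and $\mathrm{mp}(\overline{G})=0$, for every integer $r\in[0,n-1]$.
   Context: All graphs are finite, simple and undirected; $\overline{G}$ is the complement of $G$. A perfect matching is a set of edges covering every vertex exactly once; an almost-perfect matching is a set of edges covering every vertex except one exactly once and missing the remaining vertex. The matching preclusion number $\mathrm{mp}(G)$ is the minimum number of edges whose deletion leaves a graph with neither a perfect matching nor an almost-perfect matching ($\mathrm{mp}(G)=0$ if $G$ has neither). -}

module Defs where

open import Data.Nat using (ℕ; _≤_)
open import Data.Bool using (Bool; true; false; _∧_; not)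
open import Data.Bool.Properties using (∧-comm; ∧-zeroʳ)
open import Data.Fin using (Fin; _≟_; _<?_)
open import Data.List using (List; length; filter; allFin; cartesianProduct)
open import Data.Product using (Σ; ∃; _×_; _,_; proj₁; proj₂)
open import Relation.Nullary using (¬_; does)
open import Relation.Nullary.Decidable using (_×-dec_)
open import Relation.Binary.PropositionalEquality using (_≡_; _≢_; refl; cong₂; sym)

record Graph (n : ℕ) : Set where
  field
    adj   : Fin n → Fin n → Bool
    adj-sym : ∀ i j → adj i j ≡ adj j i
    adj-irr : ∀ i → adj i i ≡ false
open Graph public

record EdgeSet (n : ℕ) : Set where
  field
    mem     : Fin n → Fin n → Bool
    mem-sym : ∀ i j → mem i j ≡ mem j i
open EdgeSet public

complement : ∀ {n} → Graph n → Graph n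
complement {n} G = record
  { adj = λ i j → not (adj G i j) ∧ not (does (i ≟ j))
  ; adj-sym = λ i j → cong₂ (λ a b → not a ∧ not b) (adj-sym G i j) (eqsym i j)
  ; adj-irr = λ i → irr i
  }
  where
  eqsym : ∀ (i j : Fin n) → does (i ≟ j) ≡ does (j ≟ i)
  eqsym i j with i ≟ j | j ≟ i
  ... | Relation.Nullary.yes _ | Relation.Nullary.yes _ = refl
  ... | Relation.Nullary.no _  | Relation.Nullary.no _  = refl
  ... | Relation.Nullary.yes p | Relation.Nullary.no q = Data.Empty.⊥-elim (q (sym p))
    where import Data.Empty
  ... | Relation.Nullary.no p  | Relation.Nullary.yes q = Data.Empty.⊥-elim (p (sym q))
    where import Data.Empty
  irr : ∀ (i : Fin n) → not (adj G i i) ∧ not (does (i ≟ i)) ≡ false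
  irr i with i ≟ i
  ... | Relation.Nullary.yes _ = ∧-zeroʳ (not (adj G i i))
  ... | Relation.Nullary.no p = Data.Empty.⊥-elim (p refl)
    where import Data.Empty

_⊆E_ : ∀ {n} → EdgeSet n → Graph n → Set
F ⊆E G = ∀ i j → mem F i j ≡ true → adj G i j ≡ true

_─_ : ∀ {n} → Graph n → EdgeSet n → Graph n
G ─ F = record
  { adj = λ i j → adj G i j ∧ not (mem F i j)
  ; adj-sym = λ i j → cong₂ (λ a b → a ∧ not b) (adj-sym G i j) (mem-sym F i j)
  ; adj-irr = λ i → Relation.Binary.PropositionalEquality.cong (_∧ _) (adj-irr G i)
  }

edgeCount : ∀ {n} → EdgeSet n → ℕ
edgeCount {n} F =
  length (filter (λ p → (proj₁ p <? proj₂ p) ×-dec (mem F (proj₁ p) (proj₂ p) Data.Bool.≟ true))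
                 (cartesianProduct (allFin n) (allFin n)))

CoveredOnce : ∀ {n} → EdgeSet n → Fin n → Set
CoveredOnce M v = ∃ λ u → mem M v u ≡ true × (∀ w → mem M v w ≡ true → w ≡ u)

Uncovered : ∀ {n} → EdgeSet n → Fin n → Set
Uncovered M v = ∀ u → mem M v u ≡ false

HasPerfectMatching : ∀ {n} → Graph n → Set
HasPerfectMatching {n} H = ∃ λ (M : EdgeSet n) → M ⊆E H × (∀ v → CoveredOnce M v)

HasAlmostPerfectMatching : ∀ {n} → Graph n → Set
HasAlmostPerfectMatching {n} H =
  ∃ λ (M : EdgeSet n) → M ⊆E H × ∃ λ x → Uncovered M x × (∀ v → v ≢ x → CoveredOnce M v)

IsMatchingPreclusionSet : ∀ {n} → Graph n → EdgeSet n → Set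
IsMatchingPreclusionSet G F =
  F ⊆E G × ¬ HasPerfectMatching (G ─ F) × ¬ HasAlmostPerfectMatching (G ─ F)

-- mp(G) = k : k is the minimum size of a matching preclusion set of G.
-- (When G has neither kind of matching, the empty set works, giving mp(G) = 0.)
MP : ∀ {n} → Graph n → ℕ → Set
MP {n} G k =
  (∃ λ (F : EdgeSet n) → IsMatchingPreclusionSet G F × edgeCount F ≡ k)
  × (∀ (F : EdgeSet n) → IsMatchingPreclusionSet G F → k ≤ edgeCount F)

module Submission where

open import Defs
open import Data.Nat using (ℕ; _≤_; _∸_; _+_)
open import Data.Product using (∃; _×_)
open import Relation.Binary.PropositionalEquality using (_≡_)
open import Data.Nat.Divisibility using (_∣_)

-- Take the standard 1-factorisation of K_n: vertices are the residues modulo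
-- the odd number m = n - 1 together with a point ∞; {a , b} has colour a + b
-- and {a , ∞} colour 2a (mod m), and each colour class is a perfect matching.
-- Let Gᵣ join ∞ to every vertex and join two residues when their colour is
-- below r.  Then
--   * ∞ is isolated in the complement, so (n being even) mp(Ḡᵣ) = 0;
--   * for r ≥ 1, Gᵣ contains the r edge-disjoint perfect matchings of colours
--     below r, which forces mp(Gᵣ) ≥ r, and the residue 0 has degree r, so
--     deleting its star shows mp(Gᵣ) ≤ r;
--   * G₀ is a star at ∞, which has no perfect matching, so mp(G₀) = 0.
-- The file first develops counting over Fin (degree sums, the handshake
-- lemma), then general facts about matchings and matching preclusion sets,
-- then the arithmetic modulo m, the 1-factorisation and the graphs Gᵣ, and
-- finally the theorem.

open import Data.Nat as ℕ using (zero; suc; _*_; _<_; z≤n; s≤s)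
open import Data.Nat.Properties
  using ( +-0-commutativeMonoid; +-assoc; +-identityʳ; +-comm; *-comm; suc-injective
        ; m∸n+n≡m; m∸[m∸n]≡n; m∸n≤m; <⇒≤; <⇒≢; <-≤-trans; ≤-pred; n<1+n)
open import Data.Nat.DivMod
  using (_%_; %-distribˡ-+; %-distribˡ-*; m%n%n≡m%n; [m+n]%n≡m%n; [m+kn]%n≡m%n; m<n⇒m%n≡m; m%n<n)
open import Data.Nat.Divisibility using (divides; ∣m∣n⇒∣m+n; ∣m+n∣m⇒∣n; ∣1⇒≡1)
open import Data.Nat.Tactic.RingSolver using (solve-∀)
open import Data.Fin as Fin using (Fin; toℕ) renaming (zero to fz; suc to fs)
import Data.Fin.Properties as Finₚ
import Data.Fin.Relation.Unary.Top as Top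
open Top using (‵fromℕ; ‵inject₁)
open import Data.Bool as Bool using (Bool; true; false; _∧_; not)
open import Data.Bool.Properties using (¬-not; not-injective; ∧-zeroʳ)
open import Data.Product using (_,_; proj₁; proj₂)
open import Data.Sum using (_⊎_; inj₁; inj₂; swap)
open import Data.Empty using (⊥-elim)
open import Data.List using (List; length; filter; allFin; cartesianProduct; lookup; map; tabulate; _++_)
open import Data.List.Properties using (filter-none; filter-++; length-++; map-tabulate)
import Data.List.Relation.Unary.All as All
open import Data.List.Relation.Unary.Any using (index)
open import Data.List.Relation.Unary.Any.Properties using (lookup-index)
open import Data.List.Membership.Propositional using (_∈_)
open import Data.List.Membership.Propositional.Properties
  using (∈-filter⁺; ∈-cartesianProduct⁺; ∈-cartesianProduct⁻; ∈-allFin; ∈-tabulate⁻)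
open import Function using (case_of_)
open import Function.Bundles using (_⇔_; mk⇔)
import Function.Properties.Equivalence as ⇔
open import Relation.Nullary using (¬_; ¬?; Dec; yes; no; does)
open import Relation.Nullary.Decidable using (dec-false; dec-true; does-⇔; _→-dec_; _×-dec_; _⊎-dec_)
open import Relation.Binary.PropositionalEquality
  using (_≢_; refl; sym; trans; cong; cong₂; subst; ≢-sym; module ≡-Reasoning)
open import Relation.Binary.Definitions using (tri<; tri≈; tri>)
open import Algebra.Properties.CommutativeMonoid.Sum +-0-commutativeMonoid
  using (sum; ∑-distrib-+; sum-cong-≗)

indicator : Bool → ℕ
indicator true  = 1
indicator false = 0

count : ∀ {k} → (Fin k → Bool) → ℕ
count f = sum (λ i → indicator (f i))

count-cong : ∀ {k} {f g : Fin k → Bool} → (∀ i → f i ≡ g i) → count f ≡ count g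
count-cong f≗g = sum-cong-≗ (λ i → cong indicator (f≗g i))

count-none : ∀ {k} (f : Fin k → Bool) → (∀ i → f i ≡ false) → count f ≡ 0
count-none {zero}  f none = refl
count-none {suc k} f none rewrite none fz = count-none (λ i → f (fs i)) (λ i → none (fs i))

count-unique : ∀ {k} (f : Fin k → Bool) (u : Fin k) →
               f u ≡ true → (∀ w → f w ≡ true → w ≡ u) → count f ≡ 1
count-unique {suc k} f fz fu only rewrite fu =
  cong suc (count-none _ (λ i → ¬-not (λ fi → case only (fs i) fi of λ ())))
count-unique {suc k} f (fs u) fu only rewrite ¬-not {f fz} (λ f0 → case only fz f0 of λ ()) =
  count-unique (λ i → f (fs i)) u fu (λ w fw → Finₚ.suc-injective (only (fs w) fw))

sum-allButOne : ∀ {k} (h : Fin k → ℕ) (x : Fin k) →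
                h x ≡ 0 → (∀ v → v ≢ x → h v ≡ 1) → suc (sum h) ≡ k
sum-allButOne {suc k} h fz     hx one rewrite hx =
  cong suc (sum-allOne (λ v → h (fs v)) (λ v → one (fs v) (λ ())))
  where
  sum-allOne : ∀ {j} (g : Fin j → ℕ) → (∀ v → g v ≡ 1) → sum g ≡ j
  sum-allOne {zero}  g one = refl
  sum-allOne {suc j} g one rewrite one fz = cong suc (sum-allOne (λ v → g (fs v)) (λ v → one (fs v)))
sum-allButOne {suc k} h (fs x) hx one rewrite one fz (λ ()) =
  cong suc (sum-allButOne (λ v → h (fs v)) x hx (λ v v≢x → one (fs v) (λ e → v≢x (Finₚ.suc-injective e))))

count-segment : ∀ {k} s p → s ≤ p → p < k →
  count {k} (λ j → does ((toℕ j ℕ.≟ p) ⊎-dec (toℕ j ℕ.<? s))) ≡ suc s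
count-segment {suc k} zero    zero    _         _         = cong suc (count-none {k} _ (λ _ → refl))
count-segment {suc k} zero    (suc p) _         (s≤s p<k) = count-segment zero p z≤n p<k
count-segment {suc k} (suc s) (suc p) (s≤s s≤p) (s≤s p<k) = cong suc (count-segment s p s≤p p<k)

handshake : ∀ {k} (R : Fin k → Fin k → Bool) →
            (∀ i j → R i j ≡ R j i) → (∀ i → R i i ≡ false) →
            2 ∣ sum (λ i → count (R i))
handshake {zero}  R sym-R irr-R = divides 0 refl
handshake {suc k} R sym-R irr-R =
  subst (2 ∣_) (sym degreeSum) (∣m∣n⇒∣m+n (divides A (twice A)) rest-even)
  where
  A : ℕ
  A = count (λ j → R fz (fs j))
  R′ : Fin k → Fin k → Bool
  R′ i j = R (fs i) (fs j)
  rest-even : 2 ∣ sum (λ i → count (R′ i))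
  rest-even = handshake R′ (λ i j → sym-R (fs i) (fs j)) (λ i → irr-R (fs i))
  twice : ∀ a → a + a ≡ a * 2
  twice a = trans (cong (a +_) (sym (+-identityʳ a))) (*-comm 2 a)
  column : sum (λ i → indicator (R (fs i) fz)) ≡ A
  column = sum-cong-≗ (λ i → cong indicator (sym-R (fs i) fz))
  degreeSum : sum (λ i → count (R i)) ≡ (A + A) + sum (λ i → count (R′ i))
  degreeSum = begin
    indicator (R fz fz) + A + sum (λ i → indicator (R (fs i) fz) + count (R′ i))
      ≡⟨ cong₂ _+_ (cong (λ b → indicator b + A) (irr-R fz))
                   (∑-distrib-+ (λ i → indicator (R (fs i) fz)) (λ i → count (R′ i))) ⟩
    A + (sum (λ i → indicator (R (fs i) fz)) + sum (λ i → count (R′ i)))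
      ≡⟨ cong (λ c → A + (c + sum (λ i → count (R′ i)))) column ⟩
    A + (A + sum (λ i → count (R′ i)))
      ≡⟨ sym (+-assoc A A _) ⟩
    (A + A) + sum (λ i → count (R′ i)) ∎
    where open ≡-Reasoning

edgesWhere : ∀ {n} (R : Fin n → Fin n → Set) → (∀ x y → Dec (R x y)) →
             (∀ {x y} → R x y → R y x) → EdgeSet n
edgesWhere R R? R-sym = record
  { mem     = λ x y → does (R? x y)
  ; mem-sym = λ x y → does-⇔ (mk⇔ R-sym R-sym) (R? x y) (R? y x)
  }

graphWhere : ∀ {n} (R : Fin n → Fin n → Set) → (∀ x y → Dec (R x y)) →
             (∀ {x y} → R x y → R y x) → (∀ x → ¬ R x x) → Graph n
graphWhere R R? R-sym R-irr = record
  { adj     = λ x y → does (R? x y)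
  ; adj-sym = λ x y → does-⇔ (mk⇔ R-sym R-sym) (R? x y) (R? y x)
  ; adj-irr = λ x → dec-false (R? x x) (R-irr x)
  }

holds : ∀ {A : Set} (a? : Dec A) → does a? ≡ true → A
holds (yes a) _  = a
holds (no _)  ()

degree : ∀ {n} → EdgeSet n → Fin n → ℕ
degree F v = count (mem F v)

edge-distinct : ∀ {n} (M : EdgeSet n) (G : Graph n) → M ⊆E G →
                ∀ {i j} → mem M i j ≡ true → i ≢ j
edge-distinct M G M⊆G {i} Mij refl = case trans (sym (M⊆G i i Mij)) (adj-irr G i) of λ ()

-- Parity obstruction: a graph of even order has no almost-perfect matching,
-- because the degree sum of a matching is even while an almost-perfect
-- matching has degree sum n - 1.
even⇒noAlmostPerfectMatching : ∀ {n} → 2 ∣ n → (H : Graph n) → ¬ HasAlmostPerfectMatching H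
even⇒noAlmostPerfectMatching {n} 2∣n H (M , M⊆H , x , x-free , covered) =
  2∤1 (∣m+n∣m⇒∣n (subst (2 ∣_) n≡degreeSum+1 2∣n) (handshake (mem M) (mem-sym M) loopless))
  where
  loopless : ∀ i → mem M i i ≡ false
  loopless i = ¬-not (λ Mii → edge-distinct M H M⊆H Mii refl)
  n≡degreeSum+1 : n ≡ sum (degree M) + 1
  n≡degreeSum+1 = trans (sym (sum-allButOne (degree M) x
                               (count-none (mem M x) x-free)
                               (λ v v≢x → let (u , Mvu , only) = covered v v≢x
                                          in count-unique (mem M v) u Mvu only)))
                        (+-comm 1 _)
  2∤1 : ¬ 2 ∣ 1
  2∤1 2∣1 = case ∣1⇒≡1 2∣1 of λ ()

isolated⇒noPerfectMatching : ∀ {n} (H : Graph n) (v : Fin n) →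
                             (∀ u → adj H v u ≡ false) → ¬ HasPerfectMatching H
isolated⇒noPerfectMatching H v isolated (M , M⊆H , covered) =
  let (u , Mvu , _) = covered v in case trans (sym (isolated u)) (M⊆H v u Mvu) of λ ()

sharedLeaves⇒noPerfectMatching : ∀ {n} (H : Graph n) (x y w : Fin n) → x ≢ y →
  (∀ u → adj H x u ≡ true → u ≡ w) → (∀ u → adj H y u ≡ true → u ≡ w) →
  ¬ HasPerfectMatching H
sharedLeaves⇒noPerfectMatching H x y w x≢y x-leaf y-leaf (M , M⊆H , covered) =
  x≢y (trans (partnerOfW x x-leaf) (sym (partnerOfW y y-leaf)))
  where
  partnerOfW : ∀ z → (∀ u → adj H z u ≡ true → u ≡ w) → z ≡ proj₁ (covered w)
  partnerOfW z z-leaf =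
    let (u , Mzu , _) = covered z
        u≡w = z-leaf u (M⊆H z u Mzu)
    in proj₂ (proj₂ (covered w)) z (trans (mem-sym M w z) (subst (λ u → mem M z u ≡ true) u≡w Mzu))

deletion⇒noPerfectMatching : ∀ {n} (G : Graph n) (F : EdgeSet n) →
  ¬ HasPerfectMatching G → ¬ HasPerfectMatching (G ─ F)
deletion⇒noPerfectMatching G F noPM (M , M⊆G─F , covered) =
  noPM (M , (λ i j Mij → ∧-true-left (M⊆G─F i j Mij)) , covered)
  where
  ∧-true-left : ∀ {a b} → a ∧ b ≡ true → a ≡ true
  ∧-true-left {true} _ = refl

perfectMatching-meets : ∀ {n} (G : Graph n) (F M : EdgeSet n) →
  M ⊆E G → (∀ v → CoveredOnce M v) → ¬ HasPerfectMatching (G ─ F) →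
  ∃ λ i → ∃ λ j → mem M i j ≡ true × mem F i j ≡ true
perfectMatching-meets {n} G F M M⊆G covered noPM = i , j , Mij , not-injective G─F-ij
  where
  Kept : Fin n → Fin n → Set
  Kept i j = mem M i j ≡ true → adj (G ─ F) i j ≡ true
  kept? : ∀ i j → Dec (Kept i j)
  kept? i j = (mem M i j Bool.≟ true) →-dec (adj (G ─ F) i j Bool.≟ true)
  badRow : ∃ λ i → ¬ (∀ j → Kept i j)
  badRow = Finₚ.¬∀⟶∃¬ n (λ i → ∀ j → Kept i j) (λ i → Finₚ.all? (kept? i))
                      (λ M⊆G─F → noPM (M , M⊆G─F , covered))
  i : Fin n
  i = proj₁ badRow
  badPair : ∃ λ j → ¬ Kept i j
  badPair = Finₚ.¬∀⟶∃¬ n (Kept i) (kept? i) (proj₂ badRow)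
  j : Fin n
  j = proj₁ badPair
  notKept : ∀ a b → ¬ (a ≡ true → b ≡ true) → a ≡ true × b ≡ false
  notKept true  false _ = refl , refl
  notKept true  true  h = ⊥-elim (h (λ _ → refl))
  notKept false _     h = ⊥-elim (h (λ ()))
  Mij : mem M i j ≡ true
  Mij = proj₁ (notKept _ _ (proj₂ badPair))
  G─F-ij : not (mem F i j) ≡ not true
  G─F-ij = subst (λ a → a ∧ not (mem F i j) ≡ false) (M⊆G i j Mij) (proj₂ (notKept _ _ (proj₂ badPair)))

IsListedEdge : ∀ {n} → EdgeSet n → Fin n × Fin n → Set
IsListedEdge F (i , j) = (i Fin.< j) × (mem F i j ≡ true)

isListedEdge? : ∀ {n} (F : EdgeSet n) (p : Fin n × Fin n) → Dec (IsListedEdge F p)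
isListedEdge? F (i , j) = (i Fin.<? j) ×-dec (mem F i j Bool.≟ true)

edgeList : ∀ {n} → EdgeSet n → List (Fin n × Fin n)
edgeList {n} F = filter (isListedEdge? F) (cartesianProduct (allFin n) (allFin n))

listed : ∀ {n} (F : EdgeSet n) {i j : Fin n} → i Fin.< j → mem F i j ≡ true → (i , j) ∈ edgeList F
listed F {i} {j} i<j Fij =
  ∈-filter⁺ (isListedEdge? F) (∈-cartesianProduct⁺ (∈-allFin i) (∈-allFin j)) (i<j , Fij)

listedOrientation : ∀ {n} (F M : EdgeSet n) (i j : Fin n) → i ≢ j →
  mem F i j ≡ true → mem M i j ≡ true →
  ∃ λ p → p ∈ edgeList F × mem M (proj₁ p) (proj₂ p) ≡ true
listedOrientation F M i j i≢j Fij Mij with Finₚ.<-cmp i j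
... | tri< i<j _   _   = (i , j) , listed F i<j Fij , Mij
... | tri≈ _   i≡j _   = ⊥-elim (i≢j i≡j)
... | tri> _   _   j<i = (j , i) , listed F j<i (trans (mem-sym F j i) Fij) , trans (mem-sym M j i) Mij

record DisjointPerfectMatchings {n} (G : Graph n) (r : ℕ) : Set where
  field
    matching : Fin r → EdgeSet n
    inG      : ∀ k → matching k ⊆E G
    perfect  : ∀ k v → CoveredOnce (matching k) v
    disjoint : ∀ k l i j → mem (matching k) i j ≡ true → mem (matching l) i j ≡ true → k ≡ l

-- Lower bound: a matching preclusion set meets each of r edge-disjoint
-- perfect matchings, necessarily in distinct edges, so it has at least r edges.
disjointPerfectMatchings⇒lowerBound : ∀ {n r} (G : Graph n) → DisjointPerfectMatchings G r →
  ∀ F → IsMatchingPreclusionSet G F → r ≤ edgeCount F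
disjointPerfectMatchings⇒lowerBound {r = r} G 𝓜 F (_ , noPM , _) =
  Finₚ.injective⇒≤ position-injective
  where
  open DisjointPerfectMatchings 𝓜
  hit : ∀ k → ∃ λ p → p ∈ edgeList F × mem (matching k) (proj₁ p) (proj₂ p) ≡ true
  hit k = let (i , j , Mij , Fij) = perfectMatching-meets G F (matching k) (inG k) (perfect k) noPM
          in listedOrientation F (matching k) i j (edge-distinct (matching k) G (inG k) Mij) Fij Mij
  position : Fin r → Fin (length (edgeList F))
  position k = index (proj₁ (proj₂ (hit k)))
  position-injective : ∀ {k l} → position k ≡ position l → k ≡ l
  position-injective {k} {l} same-position =
    disjoint k l _ _ (proj₂ (proj₂ (hit k)))
      (subst (λ p → mem (matching l) (proj₁ p) (proj₂ p) ≡ true) (sym same-edge) (proj₂ (proj₂ (hit l))))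
    where
    same-edge : proj₁ (hit k) ≡ proj₁ (hit l)
    same-edge = trans (lookup-index (proj₁ (proj₂ (hit k))))
                      (trans (cong (lookup (edgeList F)) same-position)
                             (sym (lookup-index (proj₁ (proj₂ (hit l))))))

∅ : ∀ {n} → EdgeSet n
∅ = record { mem = λ _ _ → false ; mem-sym = λ _ _ → refl }

edgeCount-∅ : ∀ {n} → edgeCount (∅ {n}) ≡ 0
edgeCount-∅ {n} =
  cong length (filter-none (isListedEdge? ∅) (All.universal notListed (cartesianProduct (allFin n) (allFin n))))
  where
  notListed : (p : Fin n × Fin n) → ¬ IsListedEdge ∅ p
  notListed _ (_ , ())

does-≟-true : ∀ b → does (b Bool.≟ true) ≡ b
does-≟-true true  = refl
does-≟-true false = refl

length-filter-tabulate : ∀ {A : Set} {P : A → Set} (P? : ∀ a → Dec (P a)) {k} (g : Fin k → A) →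
  length (filter P? (tabulate g)) ≡ count (λ i → does (P? (g i)))
length-filter-tabulate P? {zero}  g = refl
length-filter-tabulate P? {suc k} g with does (P? (g fz))
... | true  = cong suc (length-filter-tabulate P? (λ i → g (fs i)))
... | false = length-filter-tabulate P? (λ i → g (fs i))

-- An edge set all of whose edges contain the vertex 0 has as many edges as
-- the degree of 0: its listed edges are exactly the pairs (0 , j).
edgeCount-atZero : ∀ {N} (F : EdgeSet (suc N)) →
  (∀ x y → mem F x y ≡ true → x ≡ fz ⊎ y ≡ fz) → mem F fz fz ≡ false →
  edgeCount F ≡ degree F fz
edgeCount-atZero {N} F atZero F00 = begin
  length (filter Q (map (fz ,_) vertices ++ cartesianProduct (tabulate fs) vertices))
    ≡⟨ cong length (filter-++ Q (map (fz ,_) vertices) _) ⟩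
  length (filter Q (map (fz ,_) vertices) ++ filter Q (cartesianProduct (tabulate fs) vertices))
    ≡⟨ length-++ (filter Q (map (fz ,_) vertices)) ⟩
  length (filter Q (map (fz ,_) vertices)) + length (filter Q (cartesianProduct (tabulate fs) vertices))
    ≡⟨ cong₂ _+_ (cong (λ ps → length (filter Q ps)) (map-tabulate (λ j → j) (fz ,_)))
                 (cong length (filter-none Q (All.tabulate (λ {p} → unlisted p)))) ⟩
  length (filter Q (tabulate (fz ,_))) + 0
    ≡⟨ +-identityʳ _ ⟩
  length (filter Q (tabulate (fz ,_)))
    ≡⟨ length-filter-tabulate Q (fz ,_) ⟩
  count (λ j → does (Q (fz , j)))
    ≡⟨ count-cong fromZero ⟩
  degree F fz ∎
  where
  open ≡-Reasoning
  Q : ∀ p → Dec (IsListedEdge F p)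
  Q = isListedEdge? F
  vertices : List (Fin (suc N))
  vertices = allFin (suc N)
  unlisted : ∀ p → p ∈ cartesianProduct (tabulate fs) vertices → ¬ IsListedEdge F p
  unlisted (x , y) p∈ (x<y , Fxy) with ∈-tabulate⁻ (proj₁ (∈-cartesianProduct⁻ (tabulate fs) vertices p∈))
  ... | i , refl with atZero x y Fxy
  ...   | inj₂ refl = case x<y of λ ()
  fromZero : ∀ j → does (Q (fz , j)) ≡ mem F fz j
  fromZero fz     = trans (dec-false (Q (fz , fz)) (λ ())) (sym F00)
  fromZero (fs j) = does-≟-true (mem F fz (fs j))

InStar : ∀ {n} → Graph n → Fin n → Fin n → Fin n → Set
InStar G v x y = adj G x y ≡ true × (x ≡ v ⊎ y ≡ v)

inStar? : ∀ {n} (G : Graph n) (v x y : Fin n) → Dec (InStar G v x y)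
inStar? G v x y = (adj G x y Bool.≟ true) ×-dec ((x Fin.≟ v) ⊎-dec (y Fin.≟ v))

star : ∀ {n} → Graph n → Fin n → EdgeSet n
star G v = edgesWhere (InStar G v) (inStar? G v)
  (λ {x} {y} (Gxy , atV) → trans (adj-sym G y x) Gxy , swap atV)

star⊆E : ∀ {n} (G : Graph n) (v : Fin n) → star G v ⊆E G
star⊆E G v x y inStar = proj₁ (holds (inStar? G v x y) inStar)

degree-star : ∀ {n} (G : Graph n) (v : Fin n) → degree (star G v) v ≡ count (adj G v)
degree-star G v = count-cong (λ y →
  trans (does-⇔ (mk⇔ proj₁ (λ Gvy → Gvy , inj₁ refl)) (inStar? G v v y) (adj G v y Bool.≟ true))
        (does-≟-true (adj G v y)))

star-isolates : ∀ {n} (G : Graph n) (v : Fin n) → ∀ u → adj (G ─ star G v) v u ≡ false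
star-isolates G v u = deleted (adj G v u) _ (λ Gvu → dec-true (inStar? G v v u) (Gvu , inj₁ refl))
  where
  deleted : ∀ a b → (a ≡ true → b ≡ true) → a ∧ not b ≡ false
  deleted true  true  _ = refl
  deleted true  false a⇒b = case a⇒b refl of λ ()
  deleted false _     _ = refl

noPerfectMatching⇒mp0 : ∀ {n} → 2 ∣ n → (G : Graph n) → ¬ HasPerfectMatching G → MP G 0
noPerfectMatching⇒mp0 {n} 2∣n G noPM =
  (∅ , precludes , edgeCount-∅ {n}) , (λ _ _ → z≤n)
  where
  precludes : IsMatchingPreclusionSet G ∅
  precludes = (λ _ _ ()) , deletion⇒noPerfectMatching G ∅ noPM
            , even⇒noAlmostPerfectMatching 2∣n (G ─ ∅)

-- mp(G) = r for a graph of even order containing r edge-disjoint perfect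
-- matchings in which vertex 0 has degree r: the star of 0 is then a
-- smallest matching preclusion set.
disjointPerfectMatchings⇒mp : ∀ {N r} → 2 ∣ suc N → (G : Graph (suc N)) →
  DisjointPerfectMatchings G r → count (adj G fz) ≡ r → MP G r
disjointPerfectMatchings⇒mp 2∣n G 𝓜 degree0 =
  (star G fz , precludes , size) , disjointPerfectMatchings⇒lowerBound G 𝓜
  where
  precludes : IsMatchingPreclusionSet G (star G fz)
  precludes = star⊆E G fz
            , isolated⇒noPerfectMatching (G ─ star G fz) fz (star-isolates G fz)
            , even⇒noAlmostPerfectMatching 2∣n (G ─ star G fz)
  size : edgeCount (star G fz) ≡ _
  size = begin
    edgeCount (star G fz)     ≡⟨ edgeCount-atZero (star G fz) (λ x y e → proj₂ (holds (inStar? G fz x y) e))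
                                   (¬-not (λ e → edge-distinct (star G fz) G (star⊆E G fz) e refl)) ⟩
    degree (star G fz) fz     ≡⟨ degree-star G fz ⟩
    count (adj G fz)          ≡⟨ degree0 ⟩
    _                         ∎
    where open ≡-Reasoning

universal⇒isolatedInComplement : ∀ {n} (G : Graph n) (v : Fin n) →
  (∀ y → v ≢ y → adj G v y ≡ true) → ∀ y → adj (complement G) v y ≡ false
universal⇒isolatedInComplement G v universal y with v Fin.≟ y
... | yes _   = ∧-zeroʳ _
... | no  v≢y rewrite universal y v≢y = refl

-- Arithmetic modulo the odd number m = 2t + 1: translations x ↦ a + x and the
-- doubling x ↦ 2x are bijections of the residues, the inverse of doubling
-- being multiplication by t + 1.
module ResiduesModOdd (t : ℕ) where

  m : ℕ
  m = suc (t + t)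

  %-absorbʳ-+ : ∀ u v → (u + v % m) % m ≡ (u + v) % m
  %-absorbʳ-+ u v = begin
    (u + v % m) % m           ≡⟨ %-distribˡ-+ u (v % m) m ⟩
    (u % m + v % m % m) % m   ≡⟨ cong (λ z → (u % m + z) % m) (m%n%n≡m%n v m) ⟩
    (u % m + v % m) % m       ≡⟨ %-distribˡ-+ u v m ⟨
    (u + v) % m               ∎
    where open ≡-Reasoning

  %-absorbʳ-* : ∀ u v → (u * (v % m)) % m ≡ (u * v) % m
  %-absorbʳ-* u v = begin
    (u * (v % m)) % m         ≡⟨ %-distribˡ-* u (v % m) m ⟩
    (u % m * (v % m % m)) % m ≡⟨ cong (λ z → (u % m * z) % m) (m%n%n≡m%n v m) ⟩
    (u % m * (v % m)) % m     ≡⟨ %-distribˡ-* u v m ⟨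
    (u * v) % m               ∎
    where open ≡-Reasoning

  translate-back : ∀ a x → a ≤ m → x < m → ((m ∸ a) + (a + x) % m) % m ≡ x
  translate-back a x a≤m x<m = begin
    ((m ∸ a) + (a + x) % m) % m ≡⟨ %-absorbʳ-+ (m ∸ a) (a + x) ⟩
    ((m ∸ a) + (a + x)) % m     ≡⟨ cong (_% m) (+-assoc (m ∸ a) a x) ⟨
    ((m ∸ a) + a + x) % m       ≡⟨ cong (λ z → (z + x) % m) (m∸n+n≡m a≤m) ⟩
    (m + x) % m                 ≡⟨ cong (_% m) (+-comm m x) ⟩
    (x + m) % m                 ≡⟨ [m+n]%n≡m%n x m ⟩
    x % m                       ≡⟨ m<n⇒m%n≡m x<m ⟩
    x                           ∎
    where open ≡-Reasoning

  +-cancelˡ-% : ∀ a {b c} → a ≤ m → b < m → c < m → (a + b) % m ≡ (a + c) % m → b ≡ c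
  +-cancelˡ-% a {b} {c} a≤m b<m c<m same = begin
    b                           ≡⟨ translate-back a b a≤m b<m ⟨
    ((m ∸ a) + (a + b) % m) % m ≡⟨ cong (λ z → ((m ∸ a) + z) % m) same ⟩
    ((m ∸ a) + (a + c) % m) % m ≡⟨ translate-back a c a≤m c<m ⟩
    c                           ∎
    where open ≡-Reasoning

  difference : ℕ → ℕ → ℕ
  difference k a = ((m ∸ a) + k) % m

  difference-correct : ∀ a k → a ≤ m → k < m → (a + difference k a) % m ≡ k
  difference-correct a k a≤m k<m =
    subst (λ b → (b + difference k a) % m ≡ k) (m∸[m∸n]≡n a≤m) (translate-back (m ∸ a) k (m∸n≤m m a) k<m)

  -- Multiplication by t + 1 halves modulo m, since 2(t + 1) = m + 1.
  halve : ℕ → ℕ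
  halve k = (suc t * k) % m

  halve-double : ∀ a → a < m → halve ((a + a) % m) ≡ a
  halve-double a a<m = begin
    (suc t * ((a + a) % m)) % m ≡⟨ %-absorbʳ-* (suc t) (a + a) ⟩
    (suc t * (a + a)) % m       ≡⟨ cong (_% m) (halving t a) ⟩
    (a + a * m) % m             ≡⟨ [m+kn]%n≡m%n a a m ⟩
    a % m                       ≡⟨ m<n⇒m%n≡m a<m ⟩
    a                           ∎
    where open ≡-Reasoning
          halving : ∀ t a → suc t * (a + a) ≡ a + a * suc (t + t)
          halving = solve-∀

  double-halve : ∀ k → k < m → (halve k + halve k) % m ≡ k
  double-halve k k<m = begin
    ((suc t * k) % m + (suc t * k) % m) % m ≡⟨ %-distribˡ-+ (suc t * k) (suc t * k) m ⟨
    (suc t * k + suc t * k) % m             ≡⟨ cong (_% m) (twice-halving t k) ⟩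
    (k + k * m) % m                         ≡⟨ [m+kn]%n≡m%n k k m ⟩
    k % m                                   ≡⟨ m<n⇒m%n≡m k<m ⟩
    k                                       ∎
    where open ≡-Reasoning
          twice-halving : ∀ t k → suc t * k + suc t * k ≡ k + k * suc (t + t)
          twice-halving = solve-∀

  double-cancel : ∀ {a b} → a < m → b < m → (a + a) % m ≡ (b + b) % m → a ≡ b
  double-cancel {a} {b} a<m b<m same =
    trans (sym (halve-double a a<m)) (trans (cong halve same) (halve-double b b<m))

module ColourClasses {n} (colour : Fin n → Fin n → ℕ) (colour-sym : ∀ x y → colour x y ≡ colour y x) where

  HasColour : ℕ → Fin n → Fin n → Set
  HasColour k x y = x ≢ y × colour x y ≡ k

  hasColour? : ∀ k x y → Dec (HasColour k x y)
  hasColour? k x y = ¬? (x Fin.≟ y) ×-dec (colour x y ℕ.≟ k)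

  colourClass : ℕ → EdgeSet n
  colourClass k = edgesWhere (HasColour k) (hasColour? k)
    (λ {x} {y} (x≢y , xy-k) → ≢-sym x≢y , trans (colour-sym y x) xy-k)

  colourClass-perfect : ∀ k →
    (∀ x → ∃ λ y → HasColour k x y) →
    (∀ x y z → y ≢ x → z ≢ x → colour x y ≡ colour x z → y ≡ z) →
    ∀ v → CoveredOnce (colourClass k) v
  colourClass-perfect k partner unique v =
    let (u , v≢u , vu-k) = partner v
    in u , dec-true (hasColour? k v u) (v≢u , vu-k) , λ w vw →
         let (v≢w , vw-k) = holds (hasColour? k v w) vw
         in unique v w u (≢-sym v≢w) (≢-sym v≢u) (trans vw-k (sym vu-k))

-- The standard 1-factorisation of the complete graph on 2t + 2 vertices: the
-- vertices are the residues 0, …, m - 1 modulo m = 2t + 1 together with a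
-- vertex ∞ (the last element of Fin (m + 1)); a pair {a , b} of residues
-- gets colour a + b mod m, and {a , ∞} gets colour 2a mod m.
module OneFactorisation (t : ℕ) where

  open ResiduesModOdd t public

  Vertex : Set
  Vertex = Fin (suc m)

  ∞ : Vertex
  ∞ = Fin.fromℕ m

  vertex : Fin m → Vertex
  vertex = Fin.inject₁

  ∞≢vertex : ∀ a → ∞ ≢ vertex a
  ∞≢vertex a = Finₚ.fromℕ≢inject₁

  vertexCases : ∀ x → x ≡ ∞ ⊎ ∃ λ a → x ≡ vertex a
  vertexCases x with Top.view x
  ... | ‵fromℕ     = inj₁ refl
  ... | ‵inject₁ a = inj₂ (a , refl)

  colourOf : ∀ {x y : Vertex} → Top.View x → Top.View y → ℕ
  colourOf ‵fromℕ       ‵fromℕ       = 0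
  colourOf ‵fromℕ       (‵inject₁ b) = (toℕ b + toℕ b) % m
  colourOf (‵inject₁ a) ‵fromℕ       = (toℕ a + toℕ a) % m
  colourOf (‵inject₁ a) (‵inject₁ b) = (toℕ a + toℕ b) % m

  colour : Vertex → Vertex → ℕ
  colour x y = colourOf (Top.view x) (Top.view y)

  colour-∞-vertex : ∀ b → colour ∞ (vertex b) ≡ (toℕ b + toℕ b) % m
  colour-∞-vertex b rewrite Top.view-fromℕ m | Top.view-inject₁ b = refl

  colour-vertex-∞ : ∀ a → colour (vertex a) ∞ ≡ (toℕ a + toℕ a) % m
  colour-vertex-∞ a rewrite Top.view-fromℕ m | Top.view-inject₁ a = refl

  colour-vertex-vertex : ∀ a b → colour (vertex a) (vertex b) ≡ (toℕ a + toℕ b) % m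
  colour-vertex-vertex a b rewrite Top.view-inject₁ a | Top.view-inject₁ b = refl

  colour-sym : ∀ x y → colour x y ≡ colour y x
  colour-sym x y with Top.view x | Top.view y
  ... | ‵fromℕ     | ‵fromℕ     = refl
  ... | ‵fromℕ     | ‵inject₁ _ = refl
  ... | ‵inject₁ _ | ‵fromℕ     = refl
  ... | ‵inject₁ a | ‵inject₁ b = cong (_% m) (+-comm (toℕ a) (toℕ b))

  residue<m : ∀ (a : Fin m) → toℕ a < m
  residue<m = Finₚ.toℕ<n

  open ColourClasses colour colour-sym public

  -- Every colour k < m appears at ∞: at the residue k / 2.
  partner-∞ : ∀ {k} → k < m → ∃ λ y → HasColour k ∞ y
  partner-∞ {k} k<m = vertex c , ∞≢vertex c , (begin
    colour ∞ (vertex c)     ≡⟨ colour-∞-vertex c ⟩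
    (toℕ c + toℕ c) % m     ≡⟨ cong (λ z → (z + z) % m) (Finₚ.toℕ-fromℕ< halve<m) ⟩
    (halve k + halve k) % m ≡⟨ double-halve k k<m ⟩
    k                       ∎)
    where
    open ≡-Reasoning
    halve<m : halve k < m
    halve<m = m%n<n (suc t * k) m
    c : Fin m
    c = Fin.fromℕ< halve<m

  -- Every colour k < m appears at the residue a: at ∞ if 2a ≡ k, and otherwise
  -- at the residue k - a, which then differs from a.
  partner-vertex : ∀ {k} → k < m → ∀ a → ∃ λ y → HasColour k (vertex a) y
  partner-vertex {k} k<m a with (toℕ a + toℕ a) % m ℕ.≟ k
  ... | yes doubled = ∞ , (λ a≡∞ → ∞≢vertex a (sym a≡∞)) , trans (colour-vertex-∞ a) doubled
  ... | no  ¬doubled = vertex c , distinct , trans (colour-vertex-vertex a c) sum-is-k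
    where
    difference<m : difference k (toℕ a) < m
    difference<m = m%n<n (m ∸ toℕ a + k) m
    c : Fin m
    c = Fin.fromℕ< difference<m
    sum-is-k : (toℕ a + toℕ c) % m ≡ k
    sum-is-k = trans (cong (λ z → (toℕ a + z) % m) (Finₚ.toℕ-fromℕ< difference<m))
                     (difference-correct (toℕ a) k (<⇒≤ (residue<m a)) k<m)
    distinct : vertex a ≢ vertex c
    distinct a≡c = ¬doubled (subst (λ b → (toℕ a + toℕ b) % m ≡ k) (sym (Finₚ.inject₁-injective a≡c)) sum-is-k)

  partner : ∀ {k} → k < m → ∀ x → ∃ λ y → HasColour k x y
  partner k<m x with vertexCases x
  ... | inj₁ refl       = partner-∞ k<m
  ... | inj₂ (a , refl) = partner-vertex k<m a

  partner-unique : ∀ x y z → y ≢ x → z ≢ x → colour x y ≡ colour x z → y ≡ z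
  partner-unique x y z y≢x z≢x same with Top.view x | Top.view y | Top.view z
  ... | ‵fromℕ     | ‵fromℕ     | _          = ⊥-elim (y≢x refl)
  ... | ‵fromℕ     | ‵inject₁ _ | ‵fromℕ     = ⊥-elim (z≢x refl)
  ... | ‵fromℕ     | ‵inject₁ b | ‵inject₁ c =
    cong vertex (Finₚ.toℕ-injective (double-cancel (residue<m b) (residue<m c) same))
  ... | ‵inject₁ _ | ‵fromℕ     | ‵fromℕ     = refl
  ... | ‵inject₁ a | ‵fromℕ     | ‵inject₁ c =
    ⊥-elim (z≢x (cong vertex (Finₚ.toℕ-injective
      (sym (+-cancelˡ-% (toℕ a) (<⇒≤ (residue<m a)) (residue<m a) (residue<m c) same)))))
  ... | ‵inject₁ a | ‵inject₁ b | ‵fromℕ     =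
    ⊥-elim (y≢x (cong vertex (Finₚ.toℕ-injective
      (+-cancelˡ-% (toℕ a) (<⇒≤ (residue<m a)) (residue<m b) (residue<m a) same))))
  ... | ‵inject₁ a | ‵inject₁ b | ‵inject₁ c =
    cong vertex (Finₚ.toℕ-injective (+-cancelˡ-% (toℕ a) (<⇒≤ (residue<m a)) (residue<m b) (residue<m c) same))

  Joined : ℕ → Vertex → Vertex → Set
  Joined r x y = x ≢ y × (x ≡ ∞ ⊎ y ≡ ∞ ⊎ colour x y < r)

  joined? : ∀ r x y → Dec (Joined r x y)
  joined? r x y = ¬? (x Fin.≟ y) ×-dec ((x Fin.≟ ∞) ⊎-dec (y Fin.≟ ∞) ⊎-dec (colour x y ℕ.<? r))

  G : ℕ → Graph (suc m)
  G r = graphWhere (Joined r) (joined? r) (λ {x} {y} (x≢y , reason) → ≢-sym x≢y , swapped x y reason)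
                   (λ x (x≢x , _) → x≢x refl)
    where
    swapped : ∀ x y → x ≡ ∞ ⊎ y ≡ ∞ ⊎ colour x y < r → y ≡ ∞ ⊎ x ≡ ∞ ⊎ colour y x < r
    swapped x y (inj₁ x≡∞)         = inj₂ (inj₁ x≡∞)
    swapped x y (inj₂ (inj₁ y≡∞))  = inj₁ y≡∞
    swapped x y (inj₂ (inj₂ xy<r)) = inj₂ (inj₂ (subst (_< r) (colour-sym x y) xy<r))

  ∞-universal : ∀ r y → ∞ ≢ y → adj (G r) ∞ y ≡ true
  ∞-universal r y ∞≢y = dec-true (joined? r ∞ y) (∞≢y , inj₁ refl)

  colourClasses : ∀ r → r ≤ m → DisjointPerfectMatchings (G r) r
  colourClasses r r≤m = record
    { matching = λ k → colourClass (toℕ k)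
    ; inG      = λ k x y e →
        let (x≢y , xy-k) = holds (hasColour? (toℕ k) x y) e
        in dec-true (joined? r x y) (x≢y , inj₂ (inj₂ (subst (_< r) (sym xy-k) (Finₚ.toℕ<n k))))
    ; perfect  = λ k → colourClass-perfect (toℕ k) (partner (<-≤-trans (Finₚ.toℕ<n k) r≤m)) partner-unique
    ; disjoint = λ k l i j ek el →
        Finₚ.toℕ-injective (trans (sym (proj₂ (holds (hasColour? (toℕ k) i j) ek)))
                                  (proj₂ (holds (hasColour? (toℕ l) i j) el)))
    }

  neighbours-zero : ∀ r y → Joined r fz y ⇔ (y ≢ fz × (toℕ y ≡ m ⊎ toℕ y < r))
  neighbours-zero r y with vertexCases y
  ... | inj₁ refl = mk⇔ (λ _ → ≢-sym fz≢∞ , inj₁ (Finₚ.toℕ-fromℕ m)) (λ _ → fz≢∞ , inj₂ (inj₁ refl))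
    where
    fz≢∞ : fz ≢ ∞
    fz≢∞ = ≢-sym (∞≢vertex fz)
  ... | inj₂ (b , refl) = mk⇔ to from
    where
    colour-zero : colour fz (vertex b) ≡ toℕ (vertex b)
    colour-zero = trans (colour-vertex-vertex fz b) (trans (m<n⇒m%n≡m (residue<m b)) (sym (Finₚ.toℕ-inject₁ b)))
    to : Joined r fz (vertex b) → vertex b ≢ fz × (toℕ (vertex b) ≡ m ⊎ toℕ (vertex b) < r)
    to (_    , inj₁ fz≡∞)       = ⊥-elim (∞≢vertex fz (sym fz≡∞))
    to (_    , inj₂ (inj₁ b≡∞)) = ⊥-elim (∞≢vertex b (sym b≡∞))
    to (fz≢b , inj₂ (inj₂ c<r)) = ≢-sym fz≢b , inj₂ (subst (_< r) colour-zero c<r)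
    from : vertex b ≢ fz × (toℕ (vertex b) ≡ m ⊎ toℕ (vertex b) < r) → Joined r fz (vertex b)
    from (_    , inj₁ b≡m) = ⊥-elim (<⇒≢ (residue<m b) (trans (sym (Finₚ.toℕ-inject₁ b)) b≡m))
    from (b≢fz , inj₂ b<r) = ≢-sym b≢fz , inj₂ (inj₂ (subst (_< r) (sym colour-zero) b<r))

  degree-zero : ∀ s → suc s ≤ m → count (adj (G (suc s)) fz) ≡ suc s
  degree-zero s r≤m = begin
    indicator (adj (G (suc s)) fz fz) + count (λ j → adj (G (suc s)) fz (fs j))
      ≡⟨ cong₂ _+_ (cong indicator (adj-irr (G (suc s)) fz)) (count-cong {m} neighbour) ⟩
    count {m} (λ j → does ((toℕ j ℕ.≟ t + t) ⊎-dec (toℕ j ℕ.<? s)))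
      ≡⟨ count-segment {m} s (t + t) (≤-pred r≤m) (n<1+n (t + t)) ⟩
    suc s ∎
    where
    open ≡-Reasoning
    shifted : ∀ j → (fs j ≢ fz × (toℕ (fs j) ≡ m ⊎ toℕ (fs j) < suc s)) ⇔ (toℕ j ≡ t + t ⊎ toℕ j < s)
    shifted j = mk⇔ (λ { (_ , inj₁ j≡) → inj₁ (suc-injective j≡) ; (_ , inj₂ j<) → inj₂ (≤-pred j<) })
                    (λ { (inj₁ j≡) → (λ ()) , inj₁ (cong suc j≡) ; (inj₂ j<) → (λ ()) , inj₂ (s≤s j<) })
    neighbour : ∀ j → adj (G (suc s)) fz (fs j) ≡ does ((toℕ j ℕ.≟ t + t) ⊎-dec (toℕ j ℕ.<? s))
    neighbour j = does-⇔ (⇔.trans (neighbours-zero (suc s) (fs j)) (shifted j))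
                         (joined? (suc s) fz (fs j)) ((toℕ j ℕ.≟ t + t) ⊎-dec (toℕ j ℕ.<? s))

  -- In G₀ every residue is a leaf at ∞, so two distinct residues cannot both be matched.
  G₀-noPerfectMatching : ∀ (a b : Fin m) → a ≢ b → ¬ HasPerfectMatching (G 0)
  G₀-noPerfectMatching a b a≢b =
    sharedLeaves⇒noPerfectMatching (G 0) (vertex a) (vertex b) ∞
      (λ a≡b → a≢b (Finₚ.inject₁-injective a≡b)) (leaf a) (leaf b)
    where
    leaf : ∀ c y → adj (G 0) (vertex c) y ≡ true → y ≡ ∞
    leaf c y e with holds (joined? 0 (vertex c) y) e
    ... | _ , inj₁ c≡∞        = ⊥-elim (∞≢vertex c (sym c≡∞))
    ... | _ , inj₂ (inj₁ y≡∞) = y≡∞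

  even-order : 2 ∣ suc m
  even-order = divides (suc t) (double t)
    where
    double : ∀ t → suc (suc (t + t)) ≡ suc t * 2
    double = solve-∀

  mp-complement : ∀ r → MP (complement (G r)) 0
  mp-complement r = noPerfectMatching⇒mp0 even-order (complement (G r))
    (isolated⇒noPerfectMatching (complement (G r)) ∞ (universal⇒isolatedInComplement (G r) ∞ (∞-universal r)))

  mp-positive : ∀ s → suc s ≤ m → MP (G (suc s)) (suc s)
  mp-positive s r≤m =
    disjointPerfectMatchings⇒mp even-order (G (suc s)) (colourClasses (suc s) r≤m) (degree-zero s r≤m)

  mp-zero : ∀ (a b : Fin m) → a ≢ b → MP (G 0) 0
  mp-zero a b a≢b = noPerfectMatching⇒mp0 even-order (G 0) (G₀-noPerfectMatching a b a≢b)

realisation : ∀ t r → 1 ≤ t → r ≤ suc (t + t) →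
  ∃ λ (G : Graph (suc (suc (t + t)))) → MP G r × MP (complement G) 0
realisation (suc t′) zero    _ _   = G 0 , mp-zero fz (fs fz) (λ ()) , mp-complement 0
  where open OneFactorisation (suc t′)
realisation t       (suc s) _ r≤m = G (suc s) , mp-positive s r≤m , mp-complement (suc s)
  where open OneFactorisation t

evenOrder : ∀ n → 4 ≤ n → 2 ∣ n → ∃ λ t → 1 ≤ t × n ≡ suc (suc (t + t))
evenOrder n 4≤n (divides zero n≡0) = case subst (4 ≤_) n≡0 4≤n of λ ()
evenOrder n 4≤n (divides (suc zero) n≡2) = case subst (4 ≤_) n≡2 4≤n of λ { (s≤s (s≤s ())) }
evenOrder n 4≤n (divides (suc (suc t′)) n≡q*2) = suc t′ , s≤s z≤n , trans n≡q*2 (halves t′)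
  where
  halves : ∀ t′ → suc (suc t′) * 2 ≡ suc (suc (suc t′ + suc t′))
  halves = solve-∀

theorem5p7 : ∀ (n : ℕ) → 4 ≤ n → 2 ∣ n → ∀ (r : ℕ) → r ≤ n ∸ 1 →
    (∃ λ (G : Graph n) → ∃ λ a → ∃ λ b → MP G a × MP (complement G) b × a + b ≡ r)
    × (∃ λ (G : Graph n) → MP G r × MP (complement G) 0)
theorem5p7 n 4≤n 2∣n r r≤n-1 with evenOrder n 4≤n 2∣n
... | t , 1≤t , refl =
  let (G , mpG , mp-complement) = realisation t r 1≤t r≤n-1
  in (G , r , 0 , mpG , mp-complement , +-identityʳ r) , (G , mpG , mp-complement)
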